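{- Let $T$ be a complete binary tree with root $r(T)$ and let $I(V_T)$ be its set of internal (non-leaf) nodes. For any nonempty subset $S\subseteq I(V_T)\setminus\{r(T)\}$ such that the subgraph of $T$ induced by $S$ has exactly $m$ connected components, $|\partial S|\ge |S|+m+1$.
   Context: $\partial S$ denotes the node boundary of $S$ in $T$: the set of nodes of $T$ not in $S$ that are adjacent in $T$ to at least one node of $S$. -}

module Defs where

open import Data.Nat using (ℕ; zero; suc; _+_; _*_; _∸_; _^_; _≤_; _<_)
import Data.Nat.Properties as ℕP
open import Data.Fin using (Fin; toℕ)
open import Data.Fin.Subset using (Subset; _∈_; _∉_; ∣_∣)
open import Data.Fin.Subset.Properties using (_∈?_)
open import Data.Fin.Properties using (any?)
open import Data.Vec using (tabulate)
open import Data.Bool using (Bool)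
open import Data.Product using (Σ; ∃; _×_; _,_)
open import Data.Product.Relation.Unary.All using ()
open import Data.Sum using (_⊎_)
open import Relation.Nullary using (Dec; ¬_)
open import Relation.Nullary.Decidable using (⌊_⌋; _×-dec_; _⊎-dec_; ¬?)
open import Relation.Binary.PropositionalEquality using (_≡_)
open import Relation.Binary.Construct.Closure.ReflexiveTransitive using (Star)
open import Function.Bundles using (_⇔_)

-- The complete (perfect) binary tree T_d of height d, with 2^(d+1) - 1 nodes,
-- in heap numbering: node i has children 2i+1 and 2i+2; the root is node 0.
size : ℕ → ℕ
size d = 2 ^ suc d ∸ 1

Node : ℕ → Set
Node d = Fin (size d)

Child : ∀ d → Node d → Node d → Set
Child d u v = (toℕ v ≡ 2 * toℕ u + 1) ⊎ (toℕ v ≡ 2 * toℕ u + 2)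

Adj : ∀ d → Node d → Node d → Set
Adj d u v = Child d u v ⊎ Child d v u

child? : ∀ d (u v : Node d) → Dec (Child d u v)
child? d u v = (toℕ v ℕP.≟ 2 * toℕ u + 1) ⊎-dec (toℕ v ℕP.≟ 2 * toℕ u + 2)

adj? : ∀ d (u v : Node d) → Dec (Adj d u v)
adj? d u v = child? d u v ⊎-dec child? d v u

IsRoot : ∀ d → Node d → Set
IsRoot d v = toℕ v ≡ 0

-- internal (non-leaf) nodes: those of depth < d, i.e. heap index < 2^d - 1
Internal : ∀ d → Node d → Set
Internal d v = toℕ v < 2 ^ d ∸ 1

boundary : ∀ d → Subset (size d) → Subset (size d)
boundary d S = tabulate λ v → ⌊ ¬? (v ∈? S) ×-dec any? (λ u → (u ∈? S) ×-dec adj? d u v) ⌋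

AdjIn : ∀ d → Subset (size d) → Node d → Node d → Set
AdjIn d S u v = u ∈ S × v ∈ S × Adj d u v

-- the subgraph of T_d induced by S has exactly m connected components:
-- there is a labelling of the vertices of S by Fin m which hits every label
-- and such that two vertices of S get the same label iff they are joined
-- by a path inside the induced subgraph.
HasComponents : ∀ d → Subset (size d) → ℕ → Set
HasComponents d S m =
  Σ (Node d → Fin m) λ c →
    (∀ (k : Fin m) → ∃ λ u → u ∈ S × c u ≡ k) ×
    (∀ u v → u ∈ S → v ∈ S → (c u ≡ c v) ⇔ Star (AdjIn d S) u v)

-- Every node of S is internal, so the nodes of S have 2|S| children, all distinct.  The
-- children lying in S are exactly the nodes of S whose parent is in S, i.e. all but the tops
-- of the components; the others lie in ∂S.  So at least |S| + #tops children of S lie in ∂S,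
-- and #tops ≥ m since climbing parents inside S from any node reaches a top of its
-- component.  Finally, the parent of the topmost node of S lies in ∂S without being a child
-- of a node of S.
module Submission where

open import Defs
open import Data.Nat
  using (ℕ; zero; suc; _+_; _*_; _^_; _∸_; _≤_; _<_; z≤n; s≤s; s≤s⁻¹; ⌊_/2⌋; ⌈_/2⌉)
open import Data.Nat.Properties
open import Data.Nat.Induction using (<-wellFounded)
open import Data.Bool using (Bool; true; false; _∧_; not)
open import Data.Bool.Properties using (¬-not)
open import Data.Fin using (Fin; toℕ; fromℕ<; punchIn) renaming (zero to fzero; suc to fsuc)
open import Data.Fin.Properties
  using (any?; toℕ<n; toℕ-fromℕ<; toℕ-injective; punchInᵢ≢i; punchIn-injective)
open import Data.Fin.Subset using (Subset; _∈_; _∉_; ∣_∣; Nonempty; inside; outside)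
open import Data.Vec using ([]; _∷_; here; there)
open import Data.Vec.Properties using (lookup∘tabulate; lookup⇒[]=)
open import Data.Product using (_×_; _,_; ∃; proj₁; proj₂)
open import Data.Sum using (_⊎_; inj₁; inj₂)
open import Function using (_∘_)
open import Function.Bundles using (Equivalence)
open import Function.Definitions using (Injective)
open import Induction.WellFounded using (Acc; acc)
open import Relation.Nullary using (¬_; Dec; yes; no; contradiction)
open import Relation.Nullary.Decidable using (isYes; dec-true; isYes≗does)
open import Relation.Binary.PropositionalEquality
open import Relation.Binary.Construct.Closure.ReflexiveTransitive using (Star; ε; _◅_)
open import Algebra.Properties.CommutativeSemigroup +-commutativeSemigroup using (interchange)

∑ : ℕ → (ℕ → ℕ) → ℕ
∑ zero    f = 0
∑ (suc n) f = ∑ n f + f n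

syntax ∑ n (λ i → e) = ∑[ i < n ] e

∑-cong : ∀ n {f g : ℕ → ℕ} → (∀ {i} → i < n → f i ≡ g i) → ∑ n f ≡ ∑ n g
∑-cong zero    f≡g = refl
∑-cong (suc n) f≡g = cong₂ _+_ (∑-cong n (f≡g ∘ m<n⇒m<1+n)) (f≡g (n<1+n n))

∑-mono-≤ : ∀ n {f g : ℕ → ℕ} → (∀ {i} → i < n → f i ≤ g i) → ∑ n f ≤ ∑ n g
∑-mono-≤ zero    f≤g = z≤n
∑-mono-≤ (suc n) f≤g = +-mono-≤ (∑-mono-≤ n (f≤g ∘ m<n⇒m<1+n)) (f≤g (n<1+n n))

∑-mono-< : ∀ n {f g : ℕ → ℕ} → (∀ {i} → i < n → f i ≤ g i) →
           ∀ {j} → j < n → f j < g j → ∑ n f < ∑ n g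
∑-mono-< (suc n) f≤g j<1+n fj<gj with m<1+n⇒m<n∨m≡n j<1+n
... | inj₁ j<n  = +-mono-<-≤ (∑-mono-< n (f≤g ∘ m<n⇒m<1+n) j<n fj<gj) (f≤g (n<1+n n))
... | inj₂ refl = +-mono-≤-< (∑-mono-≤ n (f≤g ∘ m<n⇒m<1+n)) fj<gj

∑-distrib-+ : ∀ n (f g : ℕ → ℕ) → ∑[ i < n ] (f i + g i) ≡ ∑ n f + ∑ n g
∑-distrib-+ zero    f g = refl
∑-distrib-+ (suc n) f g = begin
  ∑[ i < n ] (f i + g i) + (f n + g n) ≡⟨ cong (_+ (f n + g n)) (∑-distrib-+ n f g) ⟩
  ∑ n f + ∑ n g + (f n + g n)          ≡⟨ interchange (∑ n f) (∑ n g) (f n) (g n) ⟩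
  ∑ n f + f n + (∑ n g + g n)          ∎
  where open ≡-Reasoning

∑-uncons : ∀ n (f : ℕ → ℕ) → ∑ (suc n) f ≡ f 0 + ∑[ i < n ] f (suc i)
∑-uncons zero    f = +-comm 0 (f 0)
∑-uncons (suc n) f = trans (cong (_+ f (suc n)) (∑-uncons n f)) (+-assoc (f 0) _ _)

∑-vanishing : ∀ k r (f : ℕ → ℕ) → (∀ {i} → k ≤ i → f i ≡ 0) → ∑ (r + k) f ≡ ∑ k f
∑-vanishing k zero    f f≡0 = refl
∑-vanishing k (suc r) f f≡0 = begin
  ∑ (r + k) f + f (r + k) ≡⟨ cong (∑ (r + k) f +_) (f≡0 (m≤n+m k r)) ⟩
  ∑ (r + k) f + 0         ≡⟨ +-identityʳ _ ⟩
  ∑ (r + k) f             ≡⟨ ∑-vanishing k r f f≡0 ⟩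
  ∑ k f                   ∎
  where open ≡-Reasoning

∑-⌊/2⌋ : ∀ k (f : ℕ → ℕ) → ∑[ j < k + k ] f ⌊ j /2⌋ ≡ ∑ k f + ∑ k f
∑-⌊/2⌋ zero    f = refl
∑-⌊/2⌋ (suc k) f = begin
  ∑[ j < suc k + suc k ] f ⌊ j /2⌋
    ≡⟨ cong (λ n → ∑[ j < suc n ] f ⌊ j /2⌋) (+-suc k k) ⟩
  ∑[ j < k + k ] f ⌊ j /2⌋ + f ⌊ k + k /2⌋ + f ⌈ k + k /2⌉
    ≡⟨ cong₂ _+_ (cong₂ (λ a b → a + f b) (∑-⌊/2⌋ k f) (sym (n≡⌊n+n/2⌋ k)))
                 (cong f (sym (n≡⌈n+n/2⌉ k))) ⟩
  ∑ k f + ∑ k f + f k + f k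
    ≡⟨ +-assoc (∑ k f + ∑ k f) (f k) (f k) ⟩
  ∑ k f + ∑ k f + (f k + f k)
    ≡⟨ interchange (∑ k f) (∑ k f) (f k) (f k) ⟩
  ∑ k f + f k + (∑ k f + f k) ∎
  where open ≡-Reasoning

bit : Bool → ℕ
bit false = 0
bit true  = 1

bit-split : ∀ x y → bit x ≡ bit (x ∧ y) + bit (x ∧ not y)
bit-split false y     = refl
bit-split true  false = refl
bit-split true  true  = refl

bit-split′ : ∀ x y → bit y ≡ bit (x ∧ y) + bit (not x ∧ y)
bit-split′ false y     = refl
bit-split′ true  false = refl
bit-split′ true  true  = refl

∑-bit-injection : ∀ n (t : ℕ → Bool) {m} (g : Fin m → ℕ) → Injective _≡_ _≡_ g →
                  (∀ k → g k < n) → (∀ k → t (g k) ≡ true) → m ≤ ∑[ i < n ] bit (t i)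
∑-bit-injection zero    t {zero}  g inj g<n tg = z≤n
∑-bit-injection zero    t {suc m} g inj g<n tg = contradiction (g<n fzero) λ ()
∑-bit-injection (suc n) t g inj g<n tg with any? (λ k → g k ≟ n)
... | no  g≢n = ≤-trans (∑-bit-injection n t g inj g<n′ tg) (m≤m+n _ _)
  where
  g<n′ : ∀ k → g k < n
  g<n′ k = ≤∧≢⇒< (s≤s⁻¹ (g<n k)) (λ gk≡n → g≢n (k , gk≡n))
∑-bit-injection (suc n) t {suc m} g inj g<n tg | yes (k , gk≡n) = begin
  suc m                          ≡⟨ +-comm 1 m ⟩
  m + 1                          ≤⟨ +-monoˡ-≤ 1 (∑-bit-injection n t g′ inj′ g′<n (tg ∘ punchIn k)) ⟩
  ∑[ i < n ] bit (t i) + 1       ≡⟨ cong (λ b → ∑[ i < n ] bit (t i) + bit b) (sym (tg k)) ⟩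
  ∑[ i < n ] bit (t i) + bit (t (g k)) ≡⟨ cong (λ x → ∑[ i < n ] bit (t i) + bit (t x)) gk≡n ⟩
  ∑[ i < suc n ] bit (t i)       ∎
  where
  open ≤-Reasoning
  g′ : Fin m → ℕ
  g′ = g ∘ punchIn k
  inj′ : Injective _≡_ _≡_ g′
  inj′ = punchIn-injective k _ _ ∘ inj
  g′<n : ∀ j → g′ j < n
  g′<n j = ≤∧≢⇒< (s≤s⁻¹ (g<n (punchIn k j)))
                 (λ g′j≡n → punchInᵢ≢i k j (inj (trans g′j≡n (sym gk≡n))))

has : ∀ {n} → Subset n → ℕ → Bool
has []      i       = false
has (x ∷ p) zero    = x
has (x ∷ p) (suc i) = has p i

∣p∣≡∑has : ∀ {n} (p : Subset n) → ∣ p ∣ ≡ ∑[ i < n ] bit (has p i)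
∣p∣≡∑has []                     = refl
∣p∣≡∑has {suc n} (inside  ∷ p) = trans (cong suc (∣p∣≡∑has p)) (sym (∑-uncons n _))
∣p∣≡∑has {suc n} (outside ∷ p) = trans (∣p∣≡∑has p) (sym (∑-uncons n _))

∈⇒has : ∀ {n} {p : Subset n} {v} → v ∈ p → has p (toℕ v) ≡ true
∈⇒has here      = refl
∈⇒has (there v∈p) = ∈⇒has v∈p

has⇒∈ : ∀ {n} (p : Subset n) {i} → has p i ≡ true → ∃ λ v → toℕ v ≡ i × v ∈ p
has⇒∈ (inside ∷ p) {zero}  _  = fzero , refl , here
has⇒∈ (x ∷ p)      {suc i} eq with has⇒∈ p eq
... | v , refl , v∈p = fsuc v , refl , there v∈p

least-element : ∀ {n} {p : Subset n} → Nonempty p →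
                ∃ λ v → v ∈ p × ∀ {i} → i < toℕ v → has p i ≡ false
least-element {p = inside  ∷ p} _                    = fzero , here , λ ()
least-element {p = outside ∷ p} (fsuc v , there v∈p) with least-element (v , v∈p)
... | w , w∈p , below =
  fsuc w , there w∈p , λ { {zero} _ → refl ; {suc i} i<w → below (s≤s⁻¹ i<w) }

∑-exit≡∑+∑-entry : ∀ n (s : ℕ → Bool) (π : ℕ → ℕ) →
                   ∑[ i < n ] bit (s (π i)) ≡ ∑[ i < n ] bit (s i) + ∑[ i < n ] bit (s i) →
                   ∑[ i < n ] bit (s (π i) ∧ not (s i)) ≡
                   ∑[ i < n ] bit (s i) + ∑[ i < n ] bit (not (s (π i)) ∧ s i)
∑-exit≡∑+∑-entry n s π ∑s∘π≡2∑s = +-cancelˡ-≡ both _ _ (begin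
  both + exits             ≡⟨ sym (∑-split λ i → bit-split (s (π i)) (s i)) ⟩
  ∑[ i < n ] bit (s (π i)) ≡⟨ ∑s∘π≡2∑s ⟩
  ∑s + ∑s                  ≡⟨ cong (_+ ∑s) (∑-split λ i → bit-split′ (s (π i)) (s i)) ⟩
  both + entries + ∑s      ≡⟨ +-assoc both entries ∑s ⟩
  both + (entries + ∑s)    ≡⟨ cong (both +_) (+-comm entries ∑s) ⟩
  both + (∑s + entries)    ∎)
  where
  open ≡-Reasoning
  ∑s both exits entries : ℕ
  ∑s      = ∑[ i < n ] bit (s i)
  both    = ∑[ i < n ] bit (s (π i) ∧ s i)
  exits   = ∑[ i < n ] bit (s (π i) ∧ not (s i))
  entries = ∑[ i < n ] bit (not (s (π i)) ∧ s i)
  ∑-split : ∀ {f g h : ℕ → ℕ} → (∀ i → f i ≡ g i + h i) → ∑ n f ≡ ∑ n g + ∑ n h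
  ∑-split f≡g+h = trans (∑-cong n λ {i} _ → f≡g+h i) (∑-distrib-+ n _ _)

-- parent 0 = 0 is a junk value; every use has the root outside the set being counted.
parent : ℕ → ℕ
parent zero    = zero
parent (suc j) = ⌊ j /2⌋

parent-≤ : ∀ i → parent i ≤ i
parent-≤ zero    = z≤n
parent-≤ (suc j) = m≤n⇒m≤1+n (⌊n/2⌋≤n j)

parent-< : ∀ {i} → i ≢ 0 → parent i < i
parent-< {zero}  i≢0 = contradiction refl i≢0
parent-< {suc j} _   = s≤s (⌊n/2⌋≤n j)

parent-child : ∀ j → (suc j ≡ 2 * parent (suc j) + 1) ⊎ (suc j ≡ 2 * parent (suc j) + 2)
parent-child zero          = inj₁ refl
parent-child (suc zero)    = inj₂ refl
parent-child (suc (suc j)) with parent-child j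
... | inj₁ eq = inj₁ (trans (cong (2 +_) eq) (sym (cong (_+ 1) (*-suc 2 ⌊ j /2⌋))))
... | inj₂ eq = inj₂ (trans (cong (2 +_) eq) (sym (cong (_+ 2) (*-suc 2 ⌊ j /2⌋))))

child-of-parent : ∀ {d} (p u : Node d) → toℕ u ≢ 0 → toℕ p ≡ parent (toℕ u) → Child d p u
child-of-parent p u u≢0 p≡parent-u with toℕ u
... | zero  = contradiction refl u≢0
... | suc j rewrite p≡parent-u = parent-child j

∑-parent : ∀ k (s : ℕ → Bool) → s 0 ≡ false → (∀ {i} → k ≤ i → s i ≡ false) →
           ∑[ i < suc (k + k) ] bit (s (parent i)) ≡
           ∑[ i < suc (k + k) ] bit (s i) + ∑[ i < suc (k + k) ] bit (s i)
∑-parent k s s0≡false s≡false = begin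
  ∑[ i < suc (k + k) ] bit (s (parent i))       ≡⟨ ∑-uncons (k + k) _ ⟩
  bit (s 0) + ∑[ j < k + k ] bit (s ⌊ j /2⌋)
    ≡⟨ cong (λ b → bit b + ∑[ j < k + k ] bit (s ⌊ j /2⌋)) s0≡false ⟩
  ∑[ j < k + k ] bit (s ⌊ j /2⌋)               ≡⟨ ∑-⌊/2⌋ k (bit ∘ s) ⟩
  ∑[ i < k ] bit (s i) + ∑[ i < k ] bit (s i)  ≡⟨ sym (cong₂ _+_ ∑-beyond-k ∑-beyond-k) ⟩
  ∑[ i < suc (k + k) ] bit (s i) + ∑[ i < suc (k + k) ] bit (s i) ∎
  where
  open ≡-Reasoning
  ∑-beyond-k : ∑[ i < suc (k + k) ] bit (s i) ≡ ∑[ i < k ] bit (s i)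
  ∑-beyond-k = ∑-vanishing k (suc k) (bit ∘ s) (cong bit ∘ s≡false)

size≡1+2K : ∀ d → size d ≡ suc ((2 ^ d ∸ 1) + (2 ^ d ∸ 1))
size≡1+2K d = 2*p∸1 (2 ^ d) (m^n>0 2 d)
  where
  2*p∸1 : ∀ p → 0 < p → 2 * p ∸ 1 ≡ suc ((p ∸ 1) + (p ∸ 1))
  2*p∸1 (suc q) _ = trans (+-suc q (q + 0)) (cong (λ x → suc (q + x)) (+-identityʳ q))

module Forest (d : ℕ) (S : Subset (size d)) where

  K N : ℕ
  K = 2 ^ d ∸ 1
  N = suc (K + K)

  s ∂ Top Exit : ℕ → Bool
  s = has S
  ∂ = has (boundary d S)
  Top  i = not (s (parent i)) ∧ s i
  Exit i = s (parent i) ∧ not (s i)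

  toℕ<N : (v : Node d) → toℕ v < N
  toℕ<N v = subst (toℕ v <_) (size≡1+2K d) (toℕ<n v)

  node : ∀ {i} → i < N → ∃ λ (v : Node d) → toℕ v ≡ i
  node {i} i<N = fromℕ< (subst (i <_) (sym (size≡1+2K d)) i<N) , toℕ-fromℕ< _

  ∣S∣≡∑s : ∣ S ∣ ≡ ∑[ i < N ] bit (s i)
  ∣S∣≡∑s = trans (∣p∣≡∑has S) (cong (λ n → ∑[ i < n ] bit (s i)) (size≡1+2K d))

  ∣∂S∣≡∑∂ : ∣ boundary d S ∣ ≡ ∑[ i < N ] bit (∂ i)
  ∣∂S∣≡∑∂ = trans (∣p∣≡∑has (boundary d S)) (cong (λ n → ∑[ i < n ] bit (∂ i)) (size≡1+2K d))

  Top-at : ∀ {t} → t ∈ S → s (parent (toℕ t)) ≡ false → Top (toℕ t) ≡ true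
  Top-at t∈S parent∉S rewrite ∈⇒has t∈S | parent∉S = refl

  ∂-witness : (u v : Node d) → u ∈ S → s (toℕ v) ≡ false → Adj d u v → ∂ (toℕ v) ≡ true
  ∂-witness u v u∈S v∉S adj =
    ∈⇒has (lookup⇒[]= v (boundary d S)
      (trans (lookup∘tabulate _ v) (isYes-true _ (v∉S′ , u , u∈S , adj))))
    where
    isYes-true : ∀ {A : Set} (a? : Dec A) → A → isYes a? ≡ true
    isYes-true a? a = trans (isYes≗does a?) (dec-true a? a)
    v∉S′ : v ∉ S
    v∉S′ v∈S = contradiction (trans (sym (∈⇒has v∈S)) v∉S) λ ()

  module NonrootInternal (internal-nonroot : ∀ v → v ∈ S → Internal d v × ¬ IsRoot d v) where

    s⇒internal-nonroot : ∀ {i} → s i ≡ true → i < K × i ≢ 0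
    s⇒internal-nonroot si with has⇒∈ S si
    ... | v , refl , v∈S = internal-nonroot v v∈S

    s-root : s 0 ≡ false
    s-root = ¬-not (λ s0≡true → proj₂ (s⇒internal-nonroot s0≡true) refl)

    s-leaf : ∀ {i} → K ≤ i → s i ≡ false
    s-leaf K≤i = ¬-not (λ si≡true → <⇒≱ (proj₁ (s⇒internal-nonroot si≡true)) K≤i)

    ∈S⇒nonroot : ∀ {u} → u ∈ S → toℕ u ≢ 0
    ∈S⇒nonroot u∈S = proj₂ (internal-nonroot _ u∈S)

    ∑Exit≡∣S∣+∑Top : ∑[ i < N ] bit (Exit i) ≡ ∣ S ∣ + ∑[ i < N ] bit (Top i)
    ∑Exit≡∣S∣+∑Top = trans (∑-exit≡∑+∑-entry N s parent (∑-parent K s s-root s-leaf))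
                           (cong (_+ ∑[ i < N ] bit (Top i)) (sym ∣S∣≡∑s))

    climb : (u : Node d) → Acc _<_ (toℕ u) → u ∈ S →
            ∃ λ t → t ∈ S × s (parent (toℕ t)) ≡ false × Star (AdjIn d S) u t
    climb u (acc rs) u∈S with s (parent (toℕ u)) in s-parent
    ... | false = u , u∈S , s-parent , ε
    ... | true with has⇒∈ S s-parent
    ...   | p , p≡parent-u , p∈S
          with climb p (rs (subst (_< toℕ u) (sym p≡parent-u) (parent-< (∈S⇒nonroot u∈S)))) p∈S
    ...     | t , t∈S , top , path = t , t∈S , top , u-p ◅ path
      where
      u-p : AdjIn d S u p
      u-p = u∈S , p∈S , inj₂ (child-of-parent {d} p u (∈S⇒nonroot u∈S) p≡parent-u)

    components≤tops : ∀ {m} → HasComponents d S m → m ≤ ∑[ i < N ] bit (Top i)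
    components≤tops {m} (c , onto , c≡⇔path) =
      ∑-bit-injection N Top (toℕ ∘ top) top-injective (toℕ<N ∘ top) top-Top
      where
      topOf : ∀ k → ∃ λ t → t ∈ S × s (parent (toℕ t)) ≡ false × c t ≡ k
      topOf k with onto k
      ... | u , u∈S , cu≡k with climb u (<-wellFounded (toℕ u)) u∈S
      ... | t , t∈S , top , path =
        t , t∈S , top , trans (sym (Equivalence.from (c≡⇔path u t u∈S t∈S) path)) cu≡k
      top : Fin m → Node d
      top k = proj₁ (topOf k)
      c-top : ∀ k → c (top k) ≡ k
      c-top k = proj₂ (proj₂ (proj₂ (topOf k)))
      top-injective : Injective _≡_ _≡_ (toℕ ∘ top)
      top-injective {k} {l} eq =
        trans (sym (c-top k)) (trans (cong c (toℕ-injective eq)) (c-top l))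
      top-Top : ∀ k → Top (toℕ (top k)) ≡ true
      top-Top k = Top-at (proj₁ (proj₂ (topOf k))) (proj₁ (proj₂ (proj₂ (topOf k))))

    Exit≤∂ : ∀ {i} → i < N → bit (Exit i) ≤ bit (∂ i)
    Exit≤∂ i<N with node i<N
    ... | v , refl with s (parent (toℕ v)) in parent∈S | s (toℕ v) in v∉S
    ... | false | _     = z≤n
    ... | true  | true  = z≤n
    ... | true  | false with has⇒∈ S parent∈S
    ...   | p , p≡parent-v , p∈S = ≤-reflexive (cong bit (sym ∂-v))
      where
      v≢0 : toℕ v ≢ 0
      v≢0 v≡0 = contradiction (trans (sym parent∈S) (trans (cong (s ∘ parent) v≡0) s-root)) λ ()
      ∂-v : ∂ (toℕ v) ≡ true
      ∂-v = ∂-witness p v p∈S v∉S (inj₁ (child-of-parent {d} p v v≢0 p≡parent-v))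

    -- Parents have smaller heap indices, so the parent p of the least node of S lies in ∂S
    -- while neither p nor its parent is in S.
    Exit<∂ : Nonempty S → ∃ λ i → i < N × bit (Exit i) < bit (∂ i)
    Exit<∂ ne with least-element ne
    ... | f , f∈S , below with node (≤-<-trans (parent-≤ (toℕ f)) (toℕ<N f))
    ... | p , p≡parent-f =
      toℕ p , toℕ<N p , subst₂ (λ x y → bit x < bit y) (sym Exit-p) (sym ∂-p) ≤-refl
      where
      p<f : toℕ p < toℕ f
      p<f = subst (_< toℕ f) (sym p≡parent-f) (parent-< (∈S⇒nonroot f∈S))
      p∉S : s (toℕ p) ≡ false
      p∉S = below p<f
      Exit-p : Exit (toℕ p) ≡ false
      Exit-p rewrite below (≤-<-trans (parent-≤ (toℕ p)) p<f) = refl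
      ∂-p : ∂ (toℕ p) ≡ true
      ∂-p = ∂-witness f p f∈S p∉S (inj₂ (child-of-parent {d} p f (∈S⇒nonroot f∈S) p≡parent-f))

    ∑Exit<∑∂ : Nonempty S → ∑[ i < N ] bit (Exit i) < ∑[ i < N ] bit (∂ i)
    ∑Exit<∑∂ ne with Exit<∂ ne
    ... | p , p<N , Exit<∂-at-p = ∑-mono-< N Exit≤∂ p<N Exit<∂-at-p

lemma2 : (d : ℕ) (S : Subset (size d)) (m : ℕ) →
         Nonempty S →
         (∀ v → v ∈ S → Internal d v × ¬ IsRoot d v) →
         HasComponents d S m →
         ∣ S ∣ + m + 1 ≤ ∣ boundary d S ∣
lemma2 d S m ne internal-nonroot hc = begin
  ∣ S ∣ + m + 1                        ≤⟨ +-monoˡ-≤ 1 (+-monoʳ-≤ ∣ S ∣ (components≤tops hc)) ⟩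
  ∣ S ∣ + ∑[ i < N ] bit (Top i) + 1   ≡⟨ cong (_+ 1) (sym ∑Exit≡∣S∣+∑Top) ⟩
  ∑[ i < N ] bit (Exit i) + 1          ≡⟨ +-comm _ 1 ⟩
  suc (∑[ i < N ] bit (Exit i))        ≤⟨ ∑Exit<∑∂ ne ⟩
  ∑[ i < N ] bit (∂ i)                 ≡⟨ sym ∣∂S∣≡∑∂ ⟩
  ∣ boundary d S ∣                     ∎
  where
  open ≤-Reasoning
  open Forest d S
  open NonrootInternal internal-nonroot
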